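{- Let $n\geq 1$ be an integer and $\mathbb K$ a field. Then $\mathrm{H}^*_\mu(D_{1,n-1};\mathbb K)=0$.
   Context: For integers $n,m\ge 0$, the dandelion graph $D_{n,m}$ is the digraph with vertices $v_0,w_1,\dots,w_n,x_1,\dots,x_m$ and edges $(w_i,v_0)$ for $i=1,\dots,n$ and $(v_0,x_j)$ for $j=1,\dots,m$. A multipath of a digraph $G$ is a spanning subgraph each of whose connected components is a single vertex or a simple directed path (no repeated vertex, not a cycle). Multipath cohomology $\mathrm{H}^*_\mu(G;\mathbb K)$ is the cohomology of the complex whose degree $n$ part has basis $b_H$ for multipaths $H$ with $n$ edges, with $d b_H=\sum_e(-1)^{\epsilon(H,H\cup e)}b_{H\cup e}$ over edges $e\notin H$ with $H\cup e$ a multipath, where $\epsilon(H,H\cup e)$ is the number of edges of $H$ preceding $e$ in a fixed total order of $E(G)$. -}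

module Defs where

open import Level using (Level; _⊔_)
open import Data.Nat as ℕ using (ℕ; zero; suc; _≤_)
open import Data.Fin as Fin using (Fin; zero; suc; splitAt; _↑ˡ_; _↑ʳ_; _<?_; _≟_)
open import Data.Fin.Subset using (Subset; outside)
open import Data.Fin.Permutation using (Permutation′; _⟨$⟩ʳ_)
open import Data.Vec using (lookup; _[_]≔_)
open import Data.Bool using (Bool; true; false; if_then_else_; _∧_)
open import Data.Product using (Σ; ∃; _×_; _,_)
open import Data.Sum using (inj₁; inj₂)
open import Relation.Binary.PropositionalEquality using (_≡_)
open import Relation.Nullary using (¬_)
open import Relation.Nullary.Decidable using (⌊_⌋)
open import Algebra.Bundles using (CommutativeRing)

record Field (c ℓ : Level) : Set (Level.suc (c ⊔ ℓ)) where
  field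
    commutativeRing : CommutativeRing c ℓ
  open CommutativeRing commutativeRing public
  field
    0≉1     : ¬ (0# ≈ 1#)
    inverse : ∀ x → ¬ (x ≈ 0#) → ∃ λ y → (x * y) ≈ 1#

record Digraph : Set where
  field
    #V  : ℕ
    #E  : ℕ
    src : Fin #E → Fin #V
    tgt : Fin #E → Fin #V

count : ∀ {k} → (Fin k → Bool) → ℕ
count {zero}  p = 0
count {suc k} p = (if p zero then 1 else 0) ℕ.+ count (λ i → p (suc i))

module _ (G : Digraph) where
  open Digraph G

  -- A spanning subgraph of G is given by its edge set H ⊆ E(G).
  outdeg : Subset #E → Fin #V → ℕ
  outdeg H v = count (λ e → lookup H e ∧ ⌊ src e ≟ v ⌋)

  indeg : Subset #E → Fin #V → ℕ
  indeg H v = count (λ e → lookup H e ∧ ⌊ tgt e ≟ v ⌋)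

  data Walk (H : Subset #E) : Fin #V → Fin #V → Set where
    []  : ∀ {v} → Walk H v v
    _∷_ : ∀ {v} e → lookup H e ≡ true → Walk H (tgt e) v → Walk H (src e) v

  HasCycle : Subset #E → Set
  HasCycle H = Σ (Fin #E) λ e → lookup H e ≡ true × Walk H (tgt e) (src e)

  -- Multipath: every connected component is a vertex or a simple directed path,
  -- i.e. in/out degrees ≤ 1 and no directed cycle.
  IsMultipath : Subset #E → Set
  IsMultipath H = (∀ v → outdeg H v ≤ 1) × (∀ v → indeg H v ≤ 1) × ¬ HasCycle H

  #edges : Subset #E → ℕ
  #edges H = count (lookup H)

  module Complex {c ℓ} (K : Field c ℓ) (ord : Permutation′ #E) where
    -- the fixed total order on E(G): e' precedes e iff ord e' < ord e
    open Field K using (Carrier; _≈_; _+_; -_; 0#)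

    Σ[_] : ∀ {k} → (Fin k → Carrier) → Carrier
    Σ[_] {zero}  f = 0#
    Σ[_] {suc k} f = f zero + Σ[_] (λ i → f (suc i))

    neg^ : ℕ → Carrier → Carrier
    neg^ zero    x = x
    neg^ (suc k) x = - neg^ k x

    -- ε(H, H ∪ e): number of edges of H preceding e
    ε : Subset #E → Fin #E → ℕ
    ε H e = count (λ e' → lookup H e' ∧ ⌊ (ord ⟨$⟩ʳ e') <? (ord ⟨$⟩ʳ e) ⌋)

    -- A cochain is a K-valued function on subgraphs; only its values on
    -- multipaths (of the relevant degree) are meaningful: the cochain
    -- Σ_H f(H) b_H.
    d : (Subset #E → Carrier) → Subset #E → Carrier
    d f T = Σ[ (λ e → if lookup T e
                        then neg^ (ε (T [ e ]≔ outside) e) (f (T [ e ]≔ outside))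
                        else 0#) ]

    IsCocycle : ℕ → (Subset #E → Carrier) → Set ℓ
    IsCocycle k f = ∀ T → IsMultipath T → #edges T ≡ suc k → d f T ≈ 0#

    -- f is a coboundary in degree k (for k = 0 this says f = 0 on degree-0 multipaths)
    IsCoboundary : ℕ → (Subset #E → Carrier) → Set (c ⊔ ℓ)
    IsCoboundary k f = ∃ λ (g : Subset #E → Carrier) →
      ∀ T → IsMultipath T → #edges T ≡ k → d g T ≈ f T

  CohomologyVanishes : ∀ {c ℓ} → Field c ℓ → Permutation′ #E → Set (c ⊔ ℓ)
  CohomologyVanishes K ord = ∀ k f → IsCocycle k f → IsCoboundary k f
    where open Complex K ord

-- Dandelion D_{n,m}: vertex zero = v₀, suc (i ↑ˡ m) = w_{i+1},
-- suc (n ↑ʳ j) = x_{j+1}; edges Fin (n + m): first n are (w_i, v₀),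
-- last m are (v₀, x_j).

dandelion : ℕ → ℕ → Digraph
dandelion n m = record
  { #V  = suc (n ℕ.+ m)
  ; #E  = n ℕ.+ m
  ; src = λ e → srcD (splitAt n e)
  ; tgt = λ e → tgtD (splitAt n e)
  }
  where
  open import Data.Sum using (_⊎_)
  srcD : Fin n ⊎ Fin m → Fin (suc (n ℕ.+ m))
  srcD (inj₁ i) = suc (i ↑ˡ m)
  srcD (inj₂ j) = zero
  tgtD : Fin n ⊎ Fin m → Fin (suc (n ℕ.+ m))
  tgtD (inj₁ i) = zero
  tgtD (inj₂ j) = suc (n ↑ʳ j)

-- The edge e₀ = (w₁, v₀) of D_{1,m} can be added to every multipath not containing it: w₁ has
-- no other out-edge, v₀ no other in-edge, and a dandelion has no directed cycles at all.
-- For such a free edge, sending a cochain f to cone f : S ↦ (-1)^ε(S,e₀) f(S ∪ e₀) (and 0 if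
-- e₀ ∈ S) is a contracting homotopy, d ∘ cone + cone ∘ d = id.  If f is a cocycle, cone (d f)
-- vanishes on multipaths, because T ∪ e₀ is again a multipath; hence f = d (cone f).
-- The homotopy identity comes down to ε(T, e₀) + ε(T∖e ∪ e₀, e) = ε(T∖e, e) + ε(T∖e, e₀) + 1
-- for e ∈ T, e₀ ∉ T, which holds because exactly one of e, e₀ precedes the other.
module Submission where

open import Defs
open import Level using (Level)
open import Algebra.Bundles using (CommutativeMonoid; AbelianGroup)
open import Data.Bool using (Bool; true; false; if_then_else_; _∧_)
open import Data.Bool.Properties using (∧-zeroʳ)
open import Data.Empty using (⊥-elim)
open import Data.Fin using (Fin; zero; suc; splitAt; _≟_; _<?_)
open import Data.Fin.Permutation using (Permutation′; _⟨$⟩ʳ_)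
open import Data.Fin.Properties using (suc-injective; <-cmp; <-asym; splitAt-↑ˡ; splitAt-↑ʳ)
open import Data.Fin.Subset using (Subset; inside; outside)
open import Data.Nat as ℕ using (ℕ; zero; suc; _≤_; _<_; _∸_)
open import Data.Nat.Properties
  using (+-comm; +-suc; ≤-refl; ≤-trans; ≤-reflexive; m≤n+m; <⇒≤; <⇒≱; +-commutativeSemigroup)
open import Algebra.Properties.CommutativeSemigroup +-commutativeSemigroup using (x∙yz≈y∙xz; interchange)
open import Data.Product using (_,_)
open import Data.Sum using (inj₁; inj₂; [_,_]′)
open import Data.Vec using (Vec; []; _∷_; lookup; _[_]≔_)
open import Data.Vec.Properties
  using (lookup∘update; lookup∘update′; []≔-idempotent; []≔-commutes; []≔-lookup)
open import Function using (_∘_; const)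
open import Function.Bundles using (Injection)
open import Function.Properties.Inverse using (↔⇒↣)
open import Relation.Binary using (tri<; tri≈; tri>)
open import Relation.Binary.PropositionalEquality as ≡ using (_≡_; _≢_; refl; module ≡-Reasoning)
open import Relation.Nullary using (¬_; yes; no)
open import Relation.Nullary.Decidable using (⌊_⌋)
open import Relation.Unary using (Pred; Decidable)

indicator : Bool → ℕ
indicator b = if b then 1 else 0

count-[]≔ : ∀ {k} (q : Fin k → Bool → Bool) (H : Vec Bool k) i b →
            indicator (q i (lookup H i)) ℕ.+ count (λ j → q j (lookup (H [ i ]≔ b) j))
              ≡ indicator (q i b) ℕ.+ count (λ j → q j (lookup H j))
count-[]≔ q (x ∷ H) zero    b = x∙yz≈y∙xz (indicator (q zero x)) (indicator (q zero b)) _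
count-[]≔ q (x ∷ H) (suc i) b = begin
  old + (hd + rest′) ≡⟨ x∙yz≈y∙xz old hd rest′ ⟩
  hd + (old + rest′) ≡⟨ ≡.cong (hd +_) (count-[]≔ (q ∘ suc) H i b) ⟩
  hd + (new + rest)  ≡⟨ x∙yz≈y∙xz hd new rest ⟩
  new + (hd + rest)  ∎
  where
  open ≡-Reasoning
  open import Data.Nat using (_+_)
  old new hd rest rest′ : ℕ
  old   = indicator (q (suc i) (lookup H i))
  new   = indicator (q (suc i) b)
  hd    = indicator (q zero x)
  rest  = count (λ j → q (suc j) (lookup H j))
  rest′ = count (λ j → q (suc j) (lookup (H [ i ]≔ b) j))

count-∧-≡0 : ∀ {k p} {P : Pred (Fin k) p} (P? : Decidable P) (H : Vec Bool k) →
             (∀ j → P j → lookup H j ≡ false) → count (λ j → lookup H j ∧ ⌊ P? j ⌋) ≡ 0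
count-∧-≡0 {zero}  P? []      H∌P = refl
count-∧-≡0 {suc k} P? (x ∷ H) H∌P with P? zero
... | yes P0 rewrite H∌P zero P0 = count-∧-≡0 (P? ∘ suc) H (H∌P ∘ suc)
... | no _   rewrite ∧-zeroʳ x   = count-∧-≡0 (P? ∘ suc) H (H∌P ∘ suc)

count-∧-insert-≤1 : ∀ {k p} {P : Pred (Fin k) p} (P? : Decidable P) (H : Vec Bool k) i →
                    count (λ j → lookup H j ∧ ⌊ P? j ⌋) ≤ 1 →
                    (P i → count (λ j → lookup H j ∧ ⌊ P? j ⌋) ≡ 0) →
                    count (λ j → lookup (H [ i ]≔ true) j ∧ ⌊ P? j ⌋) ≤ 1
count-∧-insert-≤1 P? H i c≤1 c≡0 with P? i | count-[]≔ (λ j b → b ∧ ⌊ P? j ⌋) H i true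
... | yes Pi | eq = ≤-trans (m≤n+m _ _) (≤-reflexive (≡.trans eq (≡.cong suc (c≡0 Pi))))
... | no _   | eq rewrite ∧-zeroʳ (lookup H i) = ≤-trans (≤-reflexive eq) c≤1

<?-total : ∀ {n} {x y : Fin n} → x ≢ y → indicator ⌊ x <? y ⌋ ℕ.+ indicator ⌊ y <? x ⌋ ≡ 1
<?-total {x = x} {y} x≢y with x <? y | y <? x
... | yes x<y | yes y<x = ⊥-elim (<-asym x<y y<x)
... | yes _   | no _    = refl
... | no _    | yes _   = refl
... | no x≮y  | no y≮x  with <-cmp x y
...   | tri< x<y _ _ = ⊥-elim (x≮y x<y)
...   | tri≈ _ x≡y _ = ⊥-elim (x≢y x≡y)
...   | tri> _ _ y<x = ⊥-elim (y≮x y<x)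

[]≔-restore : ∀ {n} {A : Set} (xs : Vec A n) i {x y} → lookup xs i ≡ x →
              (xs [ i ]≔ y) [ i ]≔ x ≡ xs
[]≔-restore xs i xsᵢ≡x =
  ≡.trans ([]≔-idempotent xs i) (≡.trans (≡.cong (xs [ i ]≔_) (≡.sym xsᵢ≡x)) ([]≔-lookup xs i))

module _ {a ℓ} (M : CommutativeMonoid a ℓ) where
  open CommutativeMonoid M
  open import Algebra.Properties.CommutativeMonoid.Sum M using (sum; sum-cong-≋; sum-replicate-zero)
  open import Relation.Binary.Reasoning.Setoid setoid

  sum-concentrated : ∀ {n} (t : Fin n → Carrier) i → (∀ j → j ≢ i → t j ≈ ε) → sum t ≈ t i
  sum-concentrated {suc n} t zero t≈ε = begin
    t zero ∙ sum (t ∘ suc)       ≈⟨ ∙-congˡ (sum-cong-≋ (λ j → t≈ε (suc j) λ ())) ⟩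
    t zero ∙ sum {n} (λ _ → ε)   ≈⟨ ∙-congˡ (sum-replicate-zero n) ⟩
    t zero ∙ ε                   ≈⟨ identityʳ _ ⟩
    t zero                       ∎
  sum-concentrated {suc n} t (suc i) t≈ε = begin
    t zero ∙ sum (t ∘ suc)   ≈⟨ ∙-congʳ (t≈ε zero λ ()) ⟩
    ε ∙ sum (t ∘ suc)        ≈⟨ identityˡ _ ⟩
    sum (t ∘ suc)            ≈⟨ sum-concentrated (t ∘ suc) i t∘suc≈ε ⟩
    t (suc i)                ∎
    where
    t∘suc≈ε : ∀ j → j ≢ i → t (suc j) ≈ ε
    t∘suc≈ε j j≢i = t≈ε (suc j) (j≢i ∘ suc-injective)

module _ {a ℓ} (A : AbelianGroup a ℓ) where
  open AbelianGroup A
  open import Algebra.Properties.CommutativeMonoid.Sum commutativeMonoid using (sum)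
  open import Algebra.Properties.AbelianGroup A using (⁻¹-∙-comm)
  open import Algebra.Properties.Group group using (ε⁻¹≈ε)

  ⁻¹-sum : ∀ {n} (t : Fin n → Carrier) → sum t ⁻¹ ≈ sum (λ i → t i ⁻¹)
  ⁻¹-sum {zero}  t = ε⁻¹≈ε
  ⁻¹-sum {suc n} t =
    trans (sym (⁻¹-∙-comm (t zero) (sum (t ∘ suc)))) (∙-congˡ (⁻¹-sum (t ∘ suc)))

module _ (G : Digraph) where
  open Digraph G

  walk-height-≤ : ∀ (h : Fin #V → ℕ) → (∀ e → h (src e) < h (tgt e)) →
                  ∀ {H a b} → Walk G H a b → h a ≤ h b
  walk-height-≤ h h↑ []          = ≤-refl
  walk-height-≤ h h↑ (_∷_ e _ w) = ≤-trans (<⇒≤ (h↑ e)) (walk-height-≤ h h↑ w)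

  height⇒acyclic : ∀ (h : Fin #V → ℕ) → (∀ e → h (src e) < h (tgt e)) → ∀ H → ¬ HasCycle G H
  height⇒acyclic h h↑ H (e , _ , w) = <⇒≱ (h↑ e) (walk-height-≤ h h↑ w)

  IsMultipath-insert : ∀ {H} e → IsMultipath G H → outdeg G H (src e) ≡ 0 → indeg G H (tgt e) ≡ 0 →
                       ¬ HasCycle G (H [ e ]≔ inside) → IsMultipath G (H [ e ]≔ inside)
  IsMultipath-insert {H} e (out≤1 , in≤1 , _) out≡0 in≡0 acyclic =
      (λ v → count-∧-insert-≤1 (λ e′ → src e′ ≟ v) H e (out≤1 v) λ { refl → out≡0 })
    , (λ v → count-∧-insert-≤1 (λ e′ → tgt e′ ≟ v) H e (in≤1 v) λ { refl → in≡0 })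
    , acyclic

  #edges-insert : ∀ {H e} → lookup H e ≡ false → #edges G (H [ e ]≔ inside) ≡ suc (#edges G H)
  #edges-insert {H} {e} e∉H =
    ≡.trans (≡.cong (λ b → indicator b ℕ.+ #edges G (H [ e ]≔ inside)) (≡.sym e∉H))
            (count-[]≔ (λ _ b → b) H e inside)

  IsFreeEdge : Fin #E → Set
  IsFreeEdge e = ∀ H → IsMultipath G H → lookup H e ≡ false → IsMultipath G (H [ e ]≔ inside)

module Cone (G : Digraph) {c ℓ} (K : Field c ℓ) (ord : Permutation′ (Digraph.#E G)) where
  open Digraph G
  open Complex G K ord
  open Field K using (Carrier; _≈_; _+_; -_; 0#; setoid; +-congˡ; -‿cong; +-identityˡ; +-identityʳ;
                      -‿inverseʳ; +-commutativeMonoid; +-abelianGroup; +-group)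
    renaming (refl to ≈-refl; trans to ≈-trans; reflexive to ≈-reflexive)
  open import Algebra.Properties.CommutativeMonoid.Sum +-commutativeMonoid using (sum; ∑-distrib-+)
  open import Algebra.Properties.Group +-group using (⁻¹-involutive; ε⁻¹≈ε)

  neg^-cong : ∀ k {x y} → x ≈ y → neg^ k x ≈ neg^ k y
  neg^-cong zero    x≈y = x≈y
  neg^-cong (suc k) x≈y = -‿cong (neg^-cong k x≈y)

  neg^-0# : ∀ k → neg^ k 0# ≈ 0#
  neg^-0# zero    = ≈-refl
  neg^-0# (suc k) = ≈-trans (-‿cong (neg^-0# k)) ε⁻¹≈ε

  neg^-+ : ∀ j k x → neg^ j (neg^ k x) ≡ neg^ (j ℕ.+ k) x
  neg^-+ zero    k x = refl
  neg^-+ (suc j) k x = ≡.cong -_ (neg^-+ j k x)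

  neg^-involutive : ∀ k x → neg^ k (neg^ k x) ≈ x
  neg^-involutive k x = ≈-trans (≈-reflexive (neg^-+ k k x)) (even k)
    where
    even : ∀ k → neg^ (k ℕ.+ k) x ≈ x
    even zero                      = ≈-refl
    even (suc k) rewrite +-suc k k = ≈-trans (⁻¹-involutive _) (even k)

  neg^-sum : ∀ k {n} (t : Fin n → Carrier) → neg^ k (sum t) ≈ sum (λ i → neg^ k (t i))
  neg^-sum zero    t = ≈-refl
  neg^-sum (suc k) t = ≈-trans (-‿cong (neg^-sum k t)) (⁻¹-sum +-abelianGroup (λ i → neg^ k (t i)))

  neg^-cancel : ∀ i j k l x → i ℕ.+ j ≡ suc (k ℕ.+ l) → neg^ k (neg^ l x) + neg^ i (neg^ j x) ≈ 0#
  neg^-cancel i j k l x i+j≡1+k+l rewrite neg^-+ k l x | neg^-+ i j x | i+j≡1+k+l = -‿inverseʳ _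

  precedes : Fin #E → Fin #E → Bool
  precedes e′ e = ⌊ (ord ⟨$⟩ʳ e′) <? (ord ⟨$⟩ʳ e) ⌋

  precedes-total : ∀ {e e′} → e ≢ e′ →
                   indicator (precedes e e′) ℕ.+ indicator (precedes e′ e) ≡ 1
  precedes-total e≢e′ = <?-total (e≢e′ ∘ Injection.injective (↔⇒↣ ord))

  ε-[]≔ : ∀ H i b e → indicator (lookup H i ∧ precedes i e) ℕ.+ ε (H [ i ]≔ b) e
                       ≡ indicator (b ∧ precedes i e) ℕ.+ ε H e
  ε-[]≔ H i b e = count-[]≔ (λ j b → b ∧ precedes j e) H i b

  ε-exchange : ∀ {T e e₀} → e ≢ e₀ → lookup T e ≡ true → lookup T e₀ ≡ false →
               let S = T [ e ]≔ outside in
               ε T e₀ ℕ.+ ε (S [ e₀ ]≔ inside) e ≡ suc (ε S e ℕ.+ ε S e₀)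
  ε-exchange {T} {e} {e₀} e≢e₀ e∈T e₀∉T = begin
    ε T e₀ ℕ.+ ε (S [ e₀ ]≔ inside) e  ≡⟨ ≡.cong₂ ℕ._+_ removed inserted ⟩
    (a ℕ.+ ε S e₀) ℕ.+ (b ℕ.+ ε S e)   ≡⟨ interchange a (ε S e₀) b (ε S e) ⟩
    (a ℕ.+ b) ℕ.+ (ε S e₀ ℕ.+ ε S e)   ≡⟨ ≡.cong₂ ℕ._+_ (precedes-total e≢e₀) (+-comm (ε S e₀) _) ⟩
    suc (ε S e ℕ.+ ε S e₀)             ∎
    where
    open ≡-Reasoning
    S : Subset #E
    S = T [ e ]≔ outside
    a b : ℕ
    a = indicator (precedes e e₀)
    b = indicator (precedes e₀ e)
    removed : ε T e₀ ≡ a ℕ.+ ε S e₀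
    removed = ≡.sym (≡.trans (≡.cong (λ x → indicator (x ∧ precedes e e₀) ℕ.+ ε S e₀)
                                     (≡.sym e∈T))
                             (ε-[]≔ T e outside e₀))
    e₀∉S : lookup S e₀ ≡ false
    e₀∉S = ≡.trans (lookup∘update′ (e≢e₀ ∘ ≡.sym) T outside) e₀∉T
    inserted : ε (S [ e₀ ]≔ inside) e ≡ b ℕ.+ ε S e
    inserted = ≡.trans (≡.cong (λ x → indicator (x ∧ precedes e₀ e) ℕ.+ ε (S [ e₀ ]≔ inside) e)
                               (≡.sym e₀∉S))
                       (ε-[]≔ S e₀ inside e)

  summand : (Subset #E → Carrier) → Subset #E → Fin #E → Carrier
  summand f T e = if lookup T e then neg^ (ε (T [ e ]≔ outside) e) (f (T [ e ]≔ outside)) else 0#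

  Σ[]≡sum : ∀ {n} (t : Fin n → Carrier) → Σ[ t ] ≡ sum t
  Σ[]≡sum {zero}  t = refl
  Σ[]≡sum {suc n} t = ≡.cong (t zero +_) (Σ[]≡sum (t ∘ suc))

  d≡sum-summand : ∀ f T → d f T ≡ sum (summand f T)
  d≡sum-summand f T = Σ[]≡sum (summand f T)

  summand-∈ : ∀ f {T e} → lookup T e ≡ true →
              summand f T e ≡ neg^ (ε (T [ e ]≔ outside) e) (f (T [ e ]≔ outside))
  summand-∈ f e∈T rewrite e∈T = refl

  summand-∉ : ∀ f {T e} → lookup T e ≡ false → summand f T e ≡ 0#
  summand-∉ f e∉T rewrite e∉T = refl

  summand-≈0 : ∀ f {T e} → (lookup T e ≡ true → f (T [ e ]≔ outside) ≈ 0#) → summand f T e ≈ 0#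
  summand-≈0 f {T} {e} f≈0 with lookup T e
  ... | true  = ≈-trans (neg^-cong k (f≈0 refl)) (neg^-0# k)
    where
    k : ℕ
    k = ε (T [ e ]≔ outside) e
  ... | false = ≈-refl

  module _ (e₀ : Fin #E) where

    cone : (Subset #E → Carrier) → Subset #E → Carrier
    cone f S = if lookup S e₀ then 0# else neg^ (ε S e₀) (f (S [ e₀ ]≔ inside))

    cone-∋ : ∀ f {S} → lookup S e₀ ≡ true → cone f S ≡ 0#
    cone-∋ f e₀∈S rewrite e₀∈S = refl

    cone-∌ : ∀ f {S} → lookup S e₀ ≡ false → cone f S ≡ neg^ (ε S e₀) (f (S [ e₀ ]≔ inside))
    cone-∌ f e₀∉S rewrite e₀∉S = refl

    d-cone-∋ : ∀ f {T} → lookup T e₀ ≡ true → d (cone f) T ≈ f T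
    d-cone-∋ f {T} e₀∈T = begin
      d (cone f) T
        ≡⟨ d≡sum-summand (cone f) T ⟩
      sum (summand (cone f) T)
        ≈⟨ sum-concentrated +-commutativeMonoid _ e₀ off-diagonal ⟩
      summand (cone f) T e₀
        ≡⟨ summand-∈ (cone f) e₀∈T ⟩
      neg^ k (cone f S)
        ≡⟨ ≡.cong (neg^ k) (cone-∌ f (lookup∘update e₀ T outside)) ⟩
      neg^ k (neg^ k (f (S [ e₀ ]≔ inside)))
        ≡⟨ ≡.cong (neg^ k ∘ neg^ k ∘ f) ([]≔-restore T e₀ e₀∈T) ⟩
      neg^ k (neg^ k (f T))
        ≈⟨ neg^-involutive k (f T) ⟩
      f T ∎
      where
      open import Relation.Binary.Reasoning.Setoid setoid
      S : Subset #E
      S = T [ e₀ ]≔ outside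
      k : ℕ
      k = ε S e₀
      off-diagonal : ∀ e → e ≢ e₀ → summand (cone f) T e ≈ 0#
      off-diagonal e e≢e₀ = summand-≈0 (cone f) λ _ →
        ≈-reflexive (cone-∋ f (≡.trans (lookup∘update′ (e≢e₀ ∘ ≡.sym) T outside) e₀∈T))

    d-cone-∌ : ∀ f {T} → lookup T e₀ ≡ false →
               d (cone f) T + neg^ (ε T e₀) (d f (T [ e₀ ]≔ inside)) ≈ f T
    d-cone-∌ f {T} e₀∉T = begin
      d (cone f) T + neg^ k (d f U)
        ≡⟨ ≡.cong₂ _+⟨k⟩_ (d≡sum-summand (cone f) T) (d≡sum-summand f U) ⟩
      sum (summand (cone f) T) + neg^ k (sum (summand f U))
        ≈⟨ +-congˡ (neg^-sum k (summand f U)) ⟩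
      sum (summand (cone f) T) + sum (λ e → neg^ k (summand f U e))
        ≈⟨ ∑-distrib-+ (summand (cone f) T) (λ e → neg^ k (summand f U e)) ⟨
      sum (λ e → summand (cone f) T e + neg^ k (summand f U e))
        ≈⟨ sum-concentrated +-commutativeMonoid _ e₀ off-diagonal ⟩
      summand (cone f) T e₀ + neg^ k (summand f U e₀)
        ≡⟨ ≡.cong₂ _+⟨k⟩_ (summand-∉ (cone f) e₀∉T) (summand-∈ f e₀∈U) ⟩
      0# + neg^ k (neg^ (ε (U [ e₀ ]≔ outside) e₀) (f (U [ e₀ ]≔ outside)))
        ≡⟨ ≡.cong (λ V → 0# + neg^ k (neg^ (ε V e₀) (f V))) ([]≔-restore T e₀ e₀∉T) ⟩
      0# + neg^ k (neg^ k (f T))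
        ≈⟨ ≈-trans (+-identityˡ _) (neg^-involutive k (f T)) ⟩
      f T ∎
      where
      open import Relation.Binary.Reasoning.Setoid setoid
      k : ℕ
      k = ε T e₀
      _+⟨k⟩_ : Carrier → Carrier → Carrier
      x +⟨k⟩ y = x + neg^ k y
      U : Subset #E
      U = T [ e₀ ]≔ inside
      e₀∈U : lookup U e₀ ≡ true
      e₀∈U = lookup∘update e₀ T inside
      off-diagonal : ∀ e → e ≢ e₀ → summand (cone f) T e + neg^ k (summand f U e) ≈ 0#
      off-diagonal e e≢e₀ = by-membership (lookup T e) refl
        where
        U≐T : lookup U e ≡ lookup T e
        U≐T = lookup∘update′ e≢e₀ T inside
        by-membership : ∀ b → lookup T e ≡ b → summand (cone f) T e + neg^ k (summand f U e) ≈ 0#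
        by-membership false e∉T = begin
          summand (cone f) T e + neg^ k (summand f U e)
            ≡⟨ ≡.cong₂ _+⟨k⟩_ (summand-∉ (cone f) e∉T) (summand-∉ f (≡.trans U≐T e∉T)) ⟩
          0# + neg^ k 0#
            ≈⟨ ≈-trans (+-identityˡ _) (neg^-0# k) ⟩
          0# ∎
        by-membership true e∈T = begin
          summand (cone f) T e + neg^ k (summand f U e)
            ≡⟨ ≡.cong₂ _+⟨k⟩_ (summand-∈ (cone f) e∈T) (summand-∈ f (≡.trans U≐T e∈T)) ⟩
          neg^ (ε S e) (cone f S) + neg^ k (neg^ (ε (U [ e ]≔ outside) e) (f (U [ e ]≔ outside)))
            ≡⟨ ≡.cong₂ (λ x V → neg^ (ε S e) x + neg^ k (neg^ (ε V e) (f V)))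
                       (cone-∌ f (≡.trans (lookup∘update′ (e≢e₀ ∘ ≡.sym) T outside) e₀∉T))
                       ([]≔-commutes T e₀ e (e≢e₀ ∘ ≡.sym)) ⟩
          neg^ (ε S e) (neg^ (ε S e₀) (f S′)) + neg^ k (neg^ (ε S′ e) (f S′))
            ≈⟨ neg^-cancel k (ε S′ e) (ε S e) (ε S e₀) (f S′)
                           (ε-exchange {T} e≢e₀ e∈T e₀∉T) ⟩
          0# ∎
          where
          S S′ : Subset #E
          S  = T [ e ]≔ outside
          S′ = S [ e₀ ]≔ inside

    cone-homotopy : ∀ f T → d (cone f) T + cone (d f) T ≈ f T
    cone-homotopy f T = by-membership (lookup T e₀) refl
      where
      by-membership : ∀ b → lookup T e₀ ≡ b → d (cone f) T + cone (d f) T ≈ f T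
      by-membership true  e₀∈T =
        ≈-trans (+-congˡ (≈-reflexive (cone-∋ (d f) e₀∈T)))
                (≈-trans (+-identityʳ _) (d-cone-∋ f e₀∈T))
      by-membership false e₀∉T =
        ≈-trans (+-congˡ (≈-reflexive (cone-∌ (d f) e₀∉T))) (d-cone-∌ f e₀∉T)

    cone-d-cocycle : IsFreeEdge G e₀ → ∀ {k f} → IsCocycle k f →
                     ∀ T → IsMultipath G T → #edges G T ≡ k → cone (d f) T ≈ 0#
    cone-d-cocycle free {k} {f} cocycle T multipath |T|≡k = by-membership (lookup T e₀) refl
      where
      by-membership : ∀ b → lookup T e₀ ≡ b → cone (d f) T ≈ 0#
      by-membership true  e₀∈T = ≈-reflexive (cone-∋ (d f) e₀∈T)
      by-membership false e₀∉T = begin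
        cone (d f) T
          ≡⟨ cone-∌ (d f) e₀∉T ⟩
        neg^ (ε T e₀) (d f (T [ e₀ ]≔ inside))
          ≈⟨ neg^-cong (ε T e₀) (cocycle _ (free T multipath e₀∉T) |U|≡1+k) ⟩
        neg^ (ε T e₀) 0#
          ≈⟨ neg^-0# (ε T e₀) ⟩
        0# ∎
        where
        open import Relation.Binary.Reasoning.Setoid setoid
        |U|≡1+k : #edges G (T [ e₀ ]≔ inside) ≡ suc k
        |U|≡1+k = ≡.trans (#edges-insert G {T} e₀∉T) (≡.cong suc |T|≡k)

free-edge⇒cohomology-vanishes : ∀ G {c ℓ} (K : Field c ℓ) ord e →
                                IsFreeEdge G e → CohomologyVanishes G K ord
free-edge⇒cohomology-vanishes G K ord e free k f cocycle = cone e f , λ T multipath |T|≡k →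
  ≈-trans (≈-sym (+-identityʳ _))
          (≈-trans (+-congˡ (≈-sym (cone-d-cocycle e free {k} {f} cocycle T multipath |T|≡k)))
                   (cone-homotopy e f T))
  where
  open Field K using (+-identityʳ; +-congˡ) renaming (sym to ≈-sym; trans to ≈-trans)
  open Cone G K ord

dandelion-height : ∀ n m → Fin (suc (n ℕ.+ m)) → ℕ
dandelion-height n m zero    = 1
dandelion-height n m (suc i) = [ const 0 , const 2 ]′ (splitAt n i)

dandelion-height-< : ∀ n m e → let open Digraph (dandelion n m) in
                     dandelion-height n m (src e) < dandelion-height n m (tgt e)
dandelion-height-< n m e with splitAt n e
... | inj₁ i rewrite splitAt-↑ˡ n i m = ≤-refl
... | inj₂ j rewrite splitAt-↑ʳ n m j = ≤-refl

dandelion-acyclic : ∀ n m H → ¬ HasCycle (dandelion n m) H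
dandelion-acyclic n m = height⇒acyclic (dandelion n m) (dandelion-height n m) (dandelion-height-< n m)

dandelion-in-edge-free : ∀ m → IsFreeEdge (dandelion 1 m) zero
dandelion-in-edge-free m H multipath e₀∉H =
  IsMultipath-insert D zero multipath
    (count-∧-≡0 (λ e → src e ≟ suc zero) H λ { zero _ → e₀∉H ; (suc _) () })
    (count-∧-≡0 (λ e → tgt e ≟ zero) H λ { zero _ → e₀∉H ; (suc _) () })
    (dandelion-acyclic 1 m _)
  where
  D : Digraph
  D = dandelion 1 m
  open Digraph D

proposition4p20 : ∀ {c ℓ : Level} (n : ℕ) → 1 ≤ n → (K : Field c ℓ)
    → (ord : Permutation′ (Digraph.#E (dandelion 1 (n ∸ 1))))
    → CohomologyVanishes (dandelion 1 (n ∸ 1)) K ord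
proposition4p20 (suc m) _ K ord =
  free-edge⇒cohomology-vanishes (dandelion 1 m) K ord zero (dandelion-in-edge-free m)
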